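{- Let $K\le P$ be positive integers, $\theta=(K,P)$, and let $K_1(\theta),K_2(\theta),\dots$ be i.i.d. random sets, each uniformly distributed over the $K$-element subsets of $\{1,\dots,P\}$. For $r\ge1$ let $U_r(\theta)=\left|\bigcup_{i=1}^rK_i(\theta)\right|$. Then for every $r=1,2,\dots$ and every integer $x$ with $K\le x\le\min(rK,P)$, $$\mathbb{P}\big[U_r(\theta)\le x\big]\le\binom{P}{x}\left(\frac{x}{P}\right)^{rK}.$$ -}

module Defs where

open import Data.Nat using (ℕ; zero; suc; _≤?_)
open import Data.Nat.Properties using (_≟_)
open import Data.Bool using (Bool)
open import Data.List using (List; []; _∷_; map; concatMap; filter; length)
open import Data.Vec using (Vec; []; _∷_)
open import Data.Fin.Subset using (Subset; inside; outside; ⊥; _∪_; ∣_∣)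

allSubsets : (P : ℕ) → List (Subset P)
allSubsets zero    = [] ∷ []
allSubsets (suc P) = concatMap (λ s → (inside ∷ s) ∷ (outside ∷ s) ∷ []) (allSubsets P)

-- All K-element subsets of {1,…,P}: the support of the uniform law of K_i(θ).
kSubsets : (K P : ℕ) → List (Subset P)
kSubsets K P = filter (λ s → ∣ s ∣ ≟ K) (allSubsets P)

-- All r-tuples (K_1,…,K_r) of K-element subsets: the (uniform) sample space
-- of the first r draws; it has (P choose K)^r equally likely outcomes.
tuples : (K P r : ℕ) → List (Vec (Subset P) r)
tuples K P zero    = [] ∷ []
tuples K P (suc r) = concatMap (λ s → map (s ∷_) (tuples K P r)) (kSubsets K P)

unionAll : ∀ {P r} → Vec (Subset P) r → Subset P
unionAll []       = ⊥
unionAll (s ∷ ss) = s ∪ unionAll ss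

U : ∀ {P r} → Vec (Subset P) r → ℕ
U ss = ∣ unionAll ss ∣

-- Number of outcomes with U_r(θ) ≤ x.  P[U_r(θ) ≤ x] = countLE K P r x / (P C K)^r.
countLE : (K P r x : ℕ) → ℕ
countLE K P r x = length (filter (λ t → U t ≤? x) (tuples K P r))

-- Multiplying out denominators, P[U ≤ x] ≤ (P C x)(x/P)^{rK} reads
--   #{(K₁,…,K_r) : U ≤ x} · P^{rK} ≤ (P C x) · x^{rK} · (P C K)^r.
--
-- If U ≤ x ≤ P, the union lies inside some x-subset T.
--   For a fixed T, exactly (|T| C K)^r tuples have all Kᵢ ⊆ T, and there are
--   (P C x) choices of T, so  #{U ≤ x} ≤ (P C x) · (x C K)^r.
--
-- * Estimate.  For x ≤ P,  (x C K)/(P C K) ≤ (x/P)^K,  proved by induction on K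
--   from the absorption identity k·(n C k) = n·(n-1 C k-1) and the monotonicity
--   of x/P under x,P ↦ x+1,P+1.
--
-- Raising the estimate to the r-th power and combining gives lemma9.
module Submission where

open import Defs
open import Data.Nat using (ℕ; zero; suc; _+_; _*_; _^_; _≤_; _⊓_; _≤?_; z≤n; s≤s; NonZero)
open import Data.Nat.Properties
open import Data.Nat.Combinatorics using (_C_; nC1≡n; nCk+nC[k+1]≡[n+1]C[k+1])
open import Data.Nat.Tactic.RingSolver using (solve-∀)
open import Data.List using (List; []; _∷_; map; concatMap; filter; length; _++_)
open import Data.List.Membership.Propositional using (_∈_)
open import Data.List.Membership.Propositional.Properties using (∈-concatMap⁺; ∈-filter⁺; ∈-filter⁻)
import Data.List.Relation.Unary.Any as Any
open Any using (here; there)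
open import Data.Vec using (Vec; []; _∷_)
open import Data.Fin.Subset using (Subset; inside; outside; ⊥; ⊤; _∪_; ∣_∣)
open import Data.Fin.Subset.Properties using (∣p∣≤n; ∣⊤∣≡n)
open import Data.Product using (Σ; _×_; _,_; proj₂)
open import Relation.Nullary using (Dec; yes; no; does)
open import Relation.Unary using (Pred; Decidable)
open import Relation.Binary.PropositionalEquality
open import Data.Bool using (if_then_else_)

∑ : ∀ {a} {A : Set a} → List A → (A → ℕ) → ℕ
∑ []       f = 0
∑ (y ∷ ys) f = f y + ∑ ys f

𝟙 : ∀ {p} {Q : Set p} → Dec Q → ℕ
𝟙 d = if does d then 1 else 0

module _ {a} {A : Set a} where

  ∑-cong : ∀ {f g : A → ℕ} → (∀ y → f y ≡ g y) → ∀ L → ∑ L f ≡ ∑ L g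
  ∑-cong f≗g []       = refl
  ∑-cong f≗g (y ∷ ys) = cong₂ _+_ (f≗g y) (∑-cong f≗g ys)

  ∑-const : ∀ {f : A → ℕ} {c} L → (∀ {y} → y ∈ L → f y ≡ c) → ∑ L f ≡ length L * c
  ∑-const []       f≡c = refl
  ∑-const (y ∷ ys) f≡c = cong₂ _+_ (f≡c (here refl)) (∑-const ys (λ y∈ → f≡c (there y∈)))

  ∈⇒≤∑ : ∀ (f : A → ℕ) {y L} → y ∈ L → f y ≤ ∑ L f
  ∈⇒≤∑ f {L = z ∷ zs} (here refl) = m≤m+n (f z) (∑ zs f)
  ∈⇒≤∑ f {L = z ∷ zs} (there y∈) = ≤-trans (∈⇒≤∑ f y∈) (m≤n+m (∑ zs f) (f z))

  ∑-++ : ∀ (f : A → ℕ) L M → ∑ (L ++ M) f ≡ ∑ L f + ∑ M f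
  ∑-++ f []       M = refl
  ∑-++ f (y ∷ ys) M = trans (cong (f y +_) (∑-++ f ys M)) (sym (+-assoc (f y) _ _))

  ∑-+ : ∀ (f g : A → ℕ) L → ∑ L (λ y → f y + g y) ≡ ∑ L f + ∑ L g
  ∑-+ f g []       = refl
  ∑-+ f g (y ∷ ys) = trans (cong (f y + g y +_) (∑-+ f g ys)) (+-interchange (f y) (g y) _ _)
    where
    +-interchange : ∀ a b c d → a + b + (c + d) ≡ a + c + (b + d)
    +-interchange = solve-∀

  ∑-*ˡ : ∀ c (f : A → ℕ) L → ∑ L (λ y → c * f y) ≡ c * ∑ L f
  ∑-*ˡ c f []       = sym (*-zeroʳ c)
  ∑-*ˡ c f (y ∷ ys) = trans (cong (c * f y +_) (∑-*ˡ c f ys)) (sym (*-distribˡ-+ c (f y) _))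

  ∑-*ʳ : ∀ c (f : A → ℕ) L → ∑ L (λ y → f y * c) ≡ ∑ L f * c
  ∑-*ʳ c f []       = refl
  ∑-*ʳ c f (y ∷ ys) = trans (cong (f y * c +_) (∑-*ʳ c f ys)) (sym (*-distribʳ-+ c (f y) _))

  ∑-filter : ∀ {p} {Q : Pred A p} (Q? : Decidable Q) (g : A → ℕ) L →
             ∑ (filter Q? L) g ≡ ∑ L (λ y → 𝟙 (Q? y) * g y)
  ∑-filter Q? g []       = refl
  ∑-filter Q? g (y ∷ ys) with Q? y
  ... | yes _ = cong₂ _+_ (sym (+-identityʳ (g y))) (∑-filter Q? g ys)
  ... | no  _ = ∑-filter Q? g ys

  length-filter≤∑ : ∀ {p} {Q : Pred A p} (Q? : Decidable Q) (g : A → ℕ) →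
                    (∀ y → Q y → 1 ≤ g y) → ∀ L → length (filter Q? L) ≤ ∑ L g
  length-filter≤∑ Q? g Q⇒1≤g []       = z≤n
  length-filter≤∑ Q? g Q⇒1≤g (y ∷ ys) with Q? y
  ... | yes q = +-mono-≤ (Q⇒1≤g y q) (length-filter≤∑ Q? g Q⇒1≤g ys)
  ... | no  _ = ≤-trans (length-filter≤∑ Q? g Q⇒1≤g ys) (m≤n+m (∑ ys g) (g y))

  length≡∑1 : ∀ (L : List A) → length L ≡ ∑ L (λ _ → 1)
  length≡∑1 []       = refl
  length≡∑1 (y ∷ ys) = cong suc (length≡∑1 ys)

module _ {a b} {A : Set a} {B : Set b} where

  ∑-concatMap : ∀ (f : B → ℕ) (h : A → List B) L → ∑ (concatMap h L) f ≡ ∑ L (λ y → ∑ (h y) f)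
  ∑-concatMap f h []       = refl
  ∑-concatMap f h (y ∷ ys) =
    trans (∑-++ f (h y) (concatMap h ys)) (cong (∑ (h y) f +_) (∑-concatMap f h ys))

  ∑-map : ∀ (f : B → ℕ) (h : A → B) L → ∑ (map h L) f ≡ ∑ L (λ y → f (h y))
  ∑-map f h []       = refl
  ∑-map f h (y ∷ ys) = cong (f (h y) +_) (∑-map f h ys)

  ∑-swap : ∀ (h : A → B → ℕ) L M → ∑ L (λ y → ∑ M (h y)) ≡ ∑ M (λ z → ∑ L (λ y → h y z))
  ∑-swap h []       M = sym (∑-zero M)
    where
    ∑-zero : ∀ M → ∑ M (λ _ → 0) ≡ 0
    ∑-zero []       = refl
    ∑-zero (_ ∷ zs) = ∑-zero zs
  ∑-swap h (y ∷ ys) M =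
    trans (cong (∑ M (h y) +_) (∑-swap h ys M)) (sym (∑-+ (h y) (λ z → ∑ ys (λ y′ → h y′ z)) M))

[_⊆_] : ∀ {n} → Subset n → Subset n → ℕ
[ []          ⊆ []          ] = 1
[ inside  ∷ s ⊆ inside  ∷ T ] = [ s ⊆ T ]
[ inside  ∷ s ⊆ outside ∷ T ] = 0
[ outside ∷ s ⊆ _       ∷ T ] = [ s ⊆ T ]

-- s ∪ u ⊆ T iff s ⊆ T and u ⊆ T: this is what makes the tuple count a power.
[∪⊆] : ∀ {n} (s u T : Subset n) → [ s ∪ u ⊆ T ] ≡ [ s ⊆ T ] * [ u ⊆ T ]
[∪⊆] []            []            []            = refl
[∪⊆] (inside  ∷ s) (inside  ∷ u) (inside  ∷ T) = [∪⊆] s u T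
[∪⊆] (inside  ∷ s) (inside  ∷ u) (outside ∷ T) = refl
[∪⊆] (inside  ∷ s) (outside ∷ u) (inside  ∷ T) = [∪⊆] s u T
[∪⊆] (inside  ∷ s) (outside ∷ u) (outside ∷ T) = refl
[∪⊆] (outside ∷ s) (inside  ∷ u) (inside  ∷ T) = [∪⊆] s u T
[∪⊆] (outside ∷ s) (inside  ∷ u) (outside ∷ T) = sym (*-zeroʳ [ s ⊆ T ])
[∪⊆] (outside ∷ s) (outside ∷ u) (_       ∷ T) = [∪⊆] s u T

[⊥⊆] : ∀ {n} (T : Subset n) → [ ⊥ ⊆ T ] ≡ 1
[⊥⊆] []      = refl
[⊥⊆] (_ ∷ T) = [⊥⊆] T

[⊆⊤] : ∀ {n} (s : Subset n) → [ s ⊆ ⊤ ] ≡ 1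
[⊆⊤] []            = refl
[⊆⊤] (inside  ∷ s) = [⊆⊤] s
[⊆⊤] (outside ∷ s) = [⊆⊤] s

allSubsets-complete : ∀ {P} (T : Subset P) → T ∈ allSubsets P
allSubsets-complete []            = here refl
allSubsets-complete (inside  ∷ T) = ∈-concatMap⁺ _ (Any.map (λ { refl → here refl }) (allSubsets-complete T))
allSubsets-complete (outside ∷ T) = ∈-concatMap⁺ _ (Any.map (λ { refl → there (here refl) }) (allSubsets-complete T))

∑-allSubsets-suc : ∀ P (w : Subset (suc P) → ℕ) →
  ∑ (allSubsets (suc P)) w ≡ ∑ (allSubsets P) (λ s → w (inside ∷ s) + w (outside ∷ s))
∑-allSubsets-suc P w = trans (∑-concatMap w _ (allSubsets P))
  (∑-cong (λ s → cong (w (inside ∷ s) +_) (+-identityʳ (w (outside ∷ s)))) (allSubsets P))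

#sized⊆ : ∀ {P} (T : Subset P) K → ∑ (allSubsets P) (λ s → 𝟙 (∣ s ∣ ≟ K) * [ s ⊆ T ]) ≡ ∣ T ∣ C K
#sized⊆ []            zero    = refl
#sized⊆ []            (suc K) = refl
#sized⊆ {suc P} (inside ∷ T) zero = trans (∑-allSubsets-suc P _) (#sized⊆ T zero)
#sized⊆ {suc P} (inside ∷ T) (suc K) = begin
  ∑ (allSubsets (suc P)) (λ s → 𝟙 (∣ s ∣ ≟ suc K) * [ s ⊆ inside ∷ T ])
    ≡⟨ ∑-allSubsets-suc P _ ⟩
  ∑ (allSubsets P) (λ s → 𝟙 (∣ s ∣ ≟ K) * [ s ⊆ T ] + 𝟙 (∣ s ∣ ≟ suc K) * [ s ⊆ T ])
    ≡⟨ ∑-+ (λ s → 𝟙 (∣ s ∣ ≟ K) * [ s ⊆ T ]) (λ s → 𝟙 (∣ s ∣ ≟ suc K) * [ s ⊆ T ]) (allSubsets P) ⟩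
  ∑ (allSubsets P) (λ s → 𝟙 (∣ s ∣ ≟ K) * [ s ⊆ T ]) + ∑ (allSubsets P) (λ s → 𝟙 (∣ s ∣ ≟ suc K) * [ s ⊆ T ])
    ≡⟨ cong₂ _+_ (#sized⊆ T K) (#sized⊆ T (suc K)) ⟩
  ∣ T ∣ C K + ∣ T ∣ C suc K
    ≡⟨ nCk+nC[k+1]≡[n+1]C[k+1] ∣ T ∣ K ⟩
  suc ∣ T ∣ C suc K ∎
  where open ≡-Reasoning
#sized⊆ {suc P} (outside ∷ T) K = trans (∑-allSubsets-suc P _)
  (trans (∑-cong (λ s → cong (_+ 𝟙 (∣ s ∣ ≟ K) * [ s ⊆ T ]) (*-zeroʳ (𝟙 (suc ∣ s ∣ ≟ K)))) (allSubsets P))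
         (#sized⊆ T K))

#kSubsets⊆ : ∀ K {P} (T : Subset P) → ∑ (kSubsets K P) (λ s → [ s ⊆ T ]) ≡ ∣ T ∣ C K
#kSubsets⊆ K {P} T = trans (∑-filter (λ s → ∣ s ∣ ≟ K) _ (allSubsets P)) (#sized⊆ T K)

#kSubsets : ∀ K P → length (kSubsets K P) ≡ P C K
#kSubsets K P = begin
  length (kSubsets K P)                  ≡⟨ length≡∑1 (kSubsets K P) ⟩
  ∑ (kSubsets K P) (λ _ → 1)             ≡⟨ ∑-cong (λ s → sym ([⊆⊤] s)) (kSubsets K P) ⟩
  ∑ (kSubsets K P) (λ s → [ s ⊆ ⊤ ])     ≡⟨ #kSubsets⊆ K {P} ⊤ ⟩
  ∣ ⊤ {P} ∣ C K                          ≡⟨ cong (_C K) (∣⊤∣≡n P) ⟩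
  P C K                                  ∎
  where open ≡-Reasoning

-- Elements of u are always kept; a point outside u is taken only while the
-- rest of u still leaves room (|u| ≤ x - 1 on the remaining coordinates).
superset-of-size : ∀ {P} (u : Subset P) x → ∣ u ∣ ≤ x → x ≤ P →
                   Σ (Subset P) λ T → ∣ T ∣ ≡ x × [ u ⊆ T ] ≡ 1
superset-of-size []            zero    _         _         = [] , refl , refl
superset-of-size (inside ∷ u)  (suc x) (s≤s u≤x) (s≤s x≤P)
  with T , ∣T∣≡x , u⊆T ← superset-of-size u x u≤x x≤P = inside ∷ T , cong suc ∣T∣≡x , u⊆T
superset-of-size (outside ∷ u) zero    u≤x       _
  with T , ∣T∣≡x , u⊆T ← superset-of-size u zero u≤x z≤n = outside ∷ T , ∣T∣≡x , u⊆T
superset-of-size (outside ∷ u) (suc x) u≤1+x     (s≤s x≤P) with ∣ u ∣ ≤? x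
... | yes u≤x
  with T , ∣T∣≡x , u⊆T ← superset-of-size u x u≤x x≤P = inside ∷ T , cong suc ∣T∣≡x , u⊆T
... | no  u≰x
  with T , ∣T∣≡x , u⊆T ← superset-of-size u (suc x) u≤1+x (≤-trans (≰⇒> u≰x) (∣p∣≤n u))
  = outside ∷ T , ∣T∣≡x , u⊆T

#tuples⊆ : ∀ K {P} r (T : Subset P) → ∑ (tuples K P r) (λ t → [ unionAll t ⊆ T ]) ≡ (∣ T ∣ C K) ^ r
#tuples⊆ K zero    T = trans (+-identityʳ _) ([⊥⊆] T)
#tuples⊆ K {P} (suc r) T = begin
  ∑ (tuples K P (suc r)) inT
    ≡⟨ ∑-concatMap inT _ (kSubsets K P) ⟩
  ∑ (kSubsets K P) (λ s → ∑ (map (s ∷_) (tuples K P r)) inT)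
    ≡⟨ ∑-cong first-inside (kSubsets K P) ⟩
  ∑ (kSubsets K P) (λ s → [ s ⊆ T ] * (∣ T ∣ C K) ^ r)
    ≡⟨ ∑-*ʳ _ (λ s → [ s ⊆ T ]) (kSubsets K P) ⟩
  ∑ (kSubsets K P) (λ s → [ s ⊆ T ]) * (∣ T ∣ C K) ^ r
    ≡⟨ cong (_* (∣ T ∣ C K) ^ r) (#kSubsets⊆ K T) ⟩
  (∣ T ∣ C K) ^ suc r ∎
  where
  open ≡-Reasoning
  inT : ∀ {n} → Vec (Subset P) n → ℕ
  inT t = [ unionAll t ⊆ T ]
  -- With the first member s fixed, the remaining r members range over an independent r-tuple.
  first-inside : ∀ s → ∑ (map (s ∷_) (tuples K P r)) inT ≡ [ s ⊆ T ] * (∣ T ∣ C K) ^ r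
  first-inside s = begin
    ∑ (map (s ∷_) (tuples K P r)) inT                        ≡⟨ ∑-map inT (s ∷_) (tuples K P r) ⟩
    ∑ (tuples K P r) (λ t → [ s ∪ unionAll t ⊆ T ])          ≡⟨ ∑-cong (λ t → [∪⊆] s (unionAll t) T) (tuples K P r) ⟩
    ∑ (tuples K P r) (λ t → [ s ⊆ T ] * inT t)               ≡⟨ ∑-*ˡ [ s ⊆ T ] inT (tuples K P r) ⟩
    [ s ⊆ T ] * ∑ (tuples K P r) inT                         ≡⟨ cong ([ s ⊆ T ] *_) (#tuples⊆ K r T) ⟩
    [ s ⊆ T ] * (∣ T ∣ C K) ^ r                              ∎

union-bound : ∀ K P r x → x ≤ P →
  countLE K P r x ≤ ∑ (kSubsets x P) (λ T → ∑ (tuples K P r) (λ t → [ unionAll t ⊆ T ]))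
union-bound K P r x x≤P = begin
  countLE K P r x
    ≤⟨ length-filter≤∑ (λ t → U t ≤? x) covers covered (tuples K P r) ⟩
  ∑ (tuples K P r) covers
    ≡⟨ ∑-swap (λ t T → [ unionAll t ⊆ T ]) (tuples K P r) (kSubsets x P) ⟩
  ∑ (kSubsets x P) (λ T → ∑ (tuples K P r) (λ t → [ unionAll t ⊆ T ])) ∎
  where
  open ≤-Reasoning
  covers : Vec (Subset P) r → ℕ
  covers t = ∑ (kSubsets x P) (λ T → [ unionAll t ⊆ T ])
  covered : ∀ t → U t ≤ x → 1 ≤ covers t
  covered t Ut≤x with T , ∣T∣≡x , t⊆T ← superset-of-size (unionAll t) x Ut≤x x≤P =
    subst (_≤ covers t) t⊆T
      (∈⇒≤∑ (λ T → [ unionAll t ⊆ T ]) (∈-filter⁺ (λ s → ∣ s ∣ ≟ x) (allSubsets-complete T) ∣T∣≡x))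

count-bound : ∀ K P r x → x ≤ P → countLE K P r x ≤ (P C x) * (x C K) ^ r
count-bound K P r x x≤P = begin
  countLE K P r x
    ≤⟨ union-bound K P r x x≤P ⟩
  ∑ (kSubsets x P) (λ T → ∑ (tuples K P r) (λ t → [ unionAll t ⊆ T ]))
    ≡⟨ ∑-cong (#tuples⊆ K r) (kSubsets x P) ⟩
  ∑ (kSubsets x P) (λ T → (∣ T ∣ C K) ^ r)
    ≡⟨ ∑-const (kSubsets x P) (λ T∈ → cong (λ n → (n C K) ^ r) (proj₂ (∈-filter⁻ (λ s → ∣ s ∣ ≟ x) {xs = allSubsets P} T∈))) ⟩
  length (kSubsets x P) * (x C K) ^ r
    ≡⟨ cong (_* (x C K) ^ r) (#kSubsets x P) ⟩
  (P C x) * (x C K) ^ r ∎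
  where open ≤-Reasoning

absorption : ∀ n k → suc k * (suc n C suc k) ≡ suc n * (n C k)
absorption zero    zero    = refl
absorption zero    (suc k) = *-zeroʳ (suc (suc k))
absorption (suc n) zero    = trans (*-identityˡ _) (trans (nC1≡n (suc (suc n))) (sym (*-identityʳ _)))
absorption (suc n) (suc k) = begin
  suc (suc k) * (suc (suc n) C suc (suc k))   ≡⟨ cong (suc (suc k) *_) (sym (nCk+nC[k+1]≡[n+1]C[k+1] (suc n) (suc k))) ⟩
  suc (suc k) * (a + b)                       ≡⟨ split (suc k) a b ⟩
  suc k * a + a + suc (suc k) * b             ≡⟨ cong₂ (λ u v → u + a + v) (absorption n k) (absorption n (suc k)) ⟩
  suc n * (n C k) + a + suc n * (n C suc k)   ≡⟨ regroup (suc n) (n C k) (n C suc k) a ⟩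
  suc n * (n C k + n C suc k) + a             ≡⟨ cong (λ u → suc n * u + a) (nCk+nC[k+1]≡[n+1]C[k+1] n k) ⟩
  suc n * a + a                               ≡⟨ +-comm (suc n * a) a ⟩
  suc (suc n) * a                             ∎
  where
  open ≡-Reasoning
  a = suc n C suc k
  b = suc n C suc (suc k)
  split : ∀ m a b → suc m * (a + b) ≡ m * a + a + suc m * b
  split = solve-∀
  regroup : ∀ m c d a → m * c + a + m * d ≡ m * (c + d) + a
  regroup = solve-∀

^-distribʳ-* : ∀ a b n → (a * b) ^ n ≡ a ^ n * b ^ n
^-distribʳ-* a b zero    = refl
^-distribʳ-* a b (suc n) = trans (cong (a * b *_) (^-distribʳ-* a b n)) (interchange a b (a ^ n) (b ^ n))
  where
  interchange : ∀ a b u v → a * b * (u * v) ≡ a * u * (b * v)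
  interchange = solve-∀

ratio-increase : ∀ {x P} → x ≤ P → x * suc P ≤ suc x * P
ratio-increase {x} {P} x≤P = subst₂ _≤_ (lhs x P) (rhs x P) (+-monoʳ-≤ (x * P) x≤P)
  where
  lhs : ∀ x P → x * P + x ≡ x * suc P
  lhs = solve-∀
  rhs : ∀ x P → x * P + P ≡ suc x * P
  rhs = solve-∀

ratio-shift : ∀ K {a b x P} .{{_ : NonZero P}} → x ≤ P →
              a * P ^ K ≤ x ^ K * b → a * suc P ^ K ≤ suc x ^ K * b
ratio-shift K {a} {b} {x} {P} x≤P bound = *-cancelʳ-≤ _ _ (P ^ K) {{m^n≢0 P K}} (begin
  a * suc P ^ K * P ^ K        ≡⟨ swap₂₃ a (suc P ^ K) (P ^ K) ⟩
  a * P ^ K * suc P ^ K        ≤⟨ *-monoˡ-≤ (suc P ^ K) bound ⟩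
  x ^ K * b * suc P ^ K        ≡⟨ swap₂₃ (x ^ K) b (suc P ^ K) ⟩
  x ^ K * suc P ^ K * b        ≡⟨ cong (_* b) (^-distribʳ-* x (suc P) K) ⟨
  (x * suc P) ^ K * b          ≤⟨ *-monoˡ-≤ b (^-monoˡ-≤ K (ratio-increase x≤P)) ⟩
  (suc x * P) ^ K * b          ≡⟨ cong (_* b) (^-distribʳ-* (suc x) P K) ⟩
  suc x ^ K * P ^ K * b        ≡⟨ swap₂₃ (suc x ^ K) b (P ^ K) ⟨
  suc x ^ K * b * P ^ K        ∎)
  where
  open ≤-Reasoning
  swap₂₃ : ∀ a u v → a * u * v ≡ a * v * u
  swap₂₃ = solve-∀

-- For x ≤ P:  (x C K)·P^K ≤ x^K·(P C K),  i.e.  (x C K)/(P C K) ≤ (x/P)^K.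
-- Induction on K: by absorption, (x+1 C K+1)/(P+1 C K+1) = (x+1)/(P+1) · (x C K)/(P C K).
binomial-ratio : ∀ K {x P} → x ≤ P → (x C K) * P ^ K ≤ x ^ K * (P C K)
binomial-ratio zero                          _         = ≤-refl
binomial-ratio (suc K) {zero}                _         = z≤n
binomial-ratio (suc K) {suc x} {suc zero}    (s≤s z≤n) = ≤-reflexive (*-comm (1 C suc K) _)
binomial-ratio (suc K) {suc x} {suc P@(suc _)} (s≤s x≤P) = *-cancelˡ-≤ (suc K) (begin
  suc K * ((suc x C suc K) * suc P ^ suc K)     ≡⟨ *-assoc (suc K) (suc x C suc K) _ ⟨
  suc K * (suc x C suc K) * suc P ^ suc K       ≡⟨ cong (_* suc P ^ suc K) (absorption x K) ⟩
  suc x * (x C K) * (suc P * suc P ^ K)         ≡⟨ interchange (suc x) (x C K) (suc P) (suc P ^ K) ⟩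
  suc x * suc P * ((x C K) * suc P ^ K)         ≤⟨ *-monoʳ-≤ (suc x * suc P) (ratio-shift K {x C K} {P C K} x≤P (binomial-ratio K x≤P)) ⟩
  suc x * suc P * (suc x ^ K * (P C K))         ≡⟨ interchange (suc x) (suc P) (suc x ^ K) (P C K) ⟩
  suc x ^ suc K * (suc P * (P C K))             ≡⟨ cong (suc x ^ suc K *_) (absorption P K) ⟨
  suc x ^ suc K * (suc K * (suc P C suc K))     ≡⟨ exchange (suc x ^ suc K) (suc K) _ ⟩
  suc K * (suc x ^ suc K * (suc P C suc K))     ∎)
  where
  open ≤-Reasoning
  interchange : ∀ a b c d → a * b * (c * d) ≡ a * c * (b * d)
  interchange = solve-∀
  exchange : ∀ a b c → a * (b * c) ≡ b * (a * c)
  exchange = solve-∀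

lemma9 : (K P : ℕ) → 1 ≤ K → K ≤ P → (r : ℕ) → 1 ≤ r → (x : ℕ) → K ≤ x → x ≤ (r * K) ⊓ P →
         countLE K P r x * P ^ (r * K) ≤ (P C x) * x ^ (r * K) * (P C K) ^ r
lemma9 K P _ _ r _ x _ x≤rK⊓P = begin
  countLE K P r x * P ^ (r * K)             ≤⟨ *-monoˡ-≤ (P ^ (r * K)) (count-bound K P r x x≤P) ⟩
  (P C x) * (x C K) ^ r * P ^ (r * K)       ≡⟨ cong ((P C x) * (x C K) ^ r *_) (^-^ P) ⟨
  (P C x) * (x C K) ^ r * (P ^ K) ^ r       ≡⟨ *-assoc (P C x) _ _ ⟩
  (P C x) * ((x C K) ^ r * (P ^ K) ^ r)     ≡⟨ cong ((P C x) *_) (^-distribʳ-* (x C K) (P ^ K) r) ⟨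
  (P C x) * ((x C K) * P ^ K) ^ r           ≤⟨ *-monoʳ-≤ (P C x) (^-monoˡ-≤ r (binomial-ratio K x≤P)) ⟩
  (P C x) * (x ^ K * (P C K)) ^ r           ≡⟨ cong ((P C x) *_) (^-distribʳ-* (x ^ K) (P C K) r) ⟩
  (P C x) * ((x ^ K) ^ r * (P C K) ^ r)     ≡⟨ *-assoc (P C x) _ _ ⟨
  (P C x) * (x ^ K) ^ r * (P C K) ^ r       ≡⟨ cong (λ z → (P C x) * z * (P C K) ^ r) (^-^ x) ⟩
  (P C x) * x ^ (r * K) * (P C K) ^ r       ∎
  where
  open ≤-Reasoning
  x≤P : x ≤ P
  x≤P = ≤-trans x≤rK⊓P (m⊓n≤n (r * K) P)
  ^-^ : ∀ m → (m ^ K) ^ r ≡ m ^ (r * K)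
  ^-^ m = trans (^-*-assoc m K r) (cong (m ^_) (*-comm K r))
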